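{- Let $k\geq 3$ be an integer and let $G$ be a connected graph containing neither a bull nor a claw as an induced subgraph, such that $G$ contains an induced cycle of length $p\geq 7$ and $\alpha(G)\geq 3$. Then $G$ is $k$-colorable, or $G$ contains $K_{k+1}$, or $G$ is (isomorphic to) a clique expansion $C_p[k_1,\ldots,k_p]$ such that there exists $i\in\{1,\ldots,p\}$ with $k_i+k_{i+1}>k$ (indices modulo $p$), or $\sum_{i=1}^{p}k_i>nk$, where $n=\lfloor p/2\rfloor$.
   Context: A bull is the graph on vertices $v_1,\ldots,v_5$ with edges $v_1v_2,v_2v_3,v_3v_4,v_4v_5,v_2v_4$ (a triangle with two pendant edges at two of its vertices). A claw is $K_{1,3}$. $\alpha(G)$ is the independence number of $G$. For $p\geq 3$ and positive integers $k_1,\ldots,k_p$, the clique expansion $C_p[k_1,\ldots,k_p]$ is obtained from the cycle $v_1\ldots v_p$ by replacing each $v_i$ by a clique $K^i$ of size $k_i$, with all edges between $K^i$ and $K^j$ if $j\equiv i\pm 1 \pmod p$ and no edges between them otherwise. A graph is $k$-colorable if it admits a proper vertex coloring with $k$ colors. -}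

module Defs where

open import Data.Nat using (ℕ; zero; suc; _+_; _*_; _≡ᵇ_; _<_; _≤_; ⌊_/2⌋)
open import Data.Bool using (Bool; true; false; _∧_; _∨_; not; T)
open import Data.Fin using (Fin; toℕ)
open import Data.Product using (Σ; _×_; _,_; ∃; proj₁; proj₂)
open import Data.Sum using (_⊎_)
open import Function.Definitions using (Injective)
open import Function.Bundles using (_↔_; Inverse)
open import Relation.Binary.PropositionalEquality using (_≡_; _≢_)
open import Relation.Binary.Construct.Closure.ReflexiveTransitive using (Star)

record Graph : Set where
  field
    size   : ℕ
    adj    : Fin size → Fin size → Bool
    sym    : ∀ u v → adj u v ≡ adj v u
    irrefl : ∀ v → adj v v ≡ false
open Graph public

Vertex : Graph → Set
Vertex G = Fin (size G)

Edge : (G : Graph) → Vertex G → Vertex G → Set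
Edge G u v = adj G u v ≡ true

Connected : Graph → Set
Connected G = ∀ (u v : Vertex G) → Star (Edge G) u v

InducedCopy : (m : ℕ) → (Fin m → Fin m → Bool) → Graph → Set
InducedCopy m R G =
  Σ (Fin m → Vertex G) λ f → Injective _≡_ _≡_ f × (∀ x y → adj G (f x) (f y) ≡ R x y)

bullEdge : ℕ → ℕ → Bool
bullEdge 0 1 = true
bullEdge 1 2 = true
bullEdge 2 3 = true
bullEdge 3 4 = true
bullEdge 1 3 = true
bullEdge _ _ = false

bull : Fin 5 → Fin 5 → Bool
bull x y = bullEdge (toℕ x) (toℕ y) ∨ bullEdge (toℕ y) (toℕ x)

clawEdge : ℕ → ℕ → Bool
clawEdge 0 (suc _) = true
clawEdge _ _ = false

claw : Fin 4 → Fin 4 → Bool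
claw x y = clawEdge (toℕ x) (toℕ y) ∨ clawEdge (toℕ y) (toℕ x)

cycSucc : (p : ℕ) → Fin p → Fin p → Bool
cycSucc p i j = (suc (toℕ i) ≡ᵇ toℕ j) ∨ ((suc (toℕ i) ≡ᵇ p) ∧ (toℕ j ≡ᵇ 0))

cycleAdj : (p : ℕ) → Fin p → Fin p → Bool
cycleAdj p i j = cycSucc p i j ∨ cycSucc p j i

HasInducedCycle : Graph → ℕ → Set
HasInducedCycle G p = InducedCopy p (cycleAdj p) G

HasClique : Graph → ℕ → Set
HasClique G m =
  Σ (Fin m → Vertex G) λ f → Injective _≡_ _≡_ f × (∀ x y → x ≢ y → adj G (f x) (f y) ≡ true)

IndepAtLeast : Graph → ℕ → Set
IndepAtLeast G m =
  Σ (Fin m → Vertex G) λ f → Injective _≡_ _≡_ f × (∀ x y → adj G (f x) (f y) ≡ false)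

Colorable : Graph → ℕ → Set
Colorable G k = Σ (Vertex G → Fin k) λ c → ∀ u v → Edge G u v → c u ≢ c v

-- clique expansion C_p[k_1,...,k_p]: vertex (i , a) is the a-th vertex of clique K^i
CEVertex : (p : ℕ) → (Fin p → ℕ) → Set
CEVertex p ks = Σ (Fin p) λ i → Fin (ks i)

ceAdj : (p : ℕ) (ks : Fin p → ℕ) → CEVertex p ks → CEVertex p ks → Bool
ceAdj p ks (i , a) (j , b) =
  ((toℕ i ≡ᵇ toℕ j) ∧ not (toℕ a ≡ᵇ toℕ b)) ∨ cycleAdj p i j

IsoCE : Graph → (p : ℕ) → (Fin p → ℕ) → Set
IsoCE G p ks =
  Σ (Vertex G ↔ CEVertex p ks) λ φ →
    ∀ u v → adj G u v ≡ ceAdj p ks (Inverse.to φ u) (Inverse.to φ v)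

sumFin : (p : ℕ) → (Fin p → ℕ) → ℕ
sumFin zero f = 0
sumFin (suc p) f = f Fin.zero + sumFin p (λ i → f (Fin.suc i))

module Submission where

-- Let f 0, …, f (p - 1) be an induced cycle of length p ≥ 7.  Claw- and bull-freeness force every
-- vertex off the cycle that has a neighbour on it to be a clone of some f j, adjacent to exactly
-- f (j - 1), f j and f (j + 1); they also force two distinct vertices, each equal to or a clone of
-- f j resp. f j', to be adjacent exactly when j and j' are equal or consecutive.  By connectivity
-- every vertex is of this kind, so G is the clique expansion C_p[k_1, …, k_p] with k_j the number of
-- vertices at position j.  If k_i + k_(i+1) ≤ k for all i and Σ k_i ≤ ⌊p/2⌋ k, going once around the
-- cycle and handing out colours modulo k colours this expansion properly.

open import Defs
open import Data.Nat using (ℕ; zero; suc; _+_; _*_; _∸_; _⊓_; _/_; _%_; _<_; _≤_; _≡ᵇ_; _≤ᵇ_; ⌊_/2⌋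
                           ; NonZero; >-nonZero⁻¹; z≤n; s≤s)
open import Data.Nat.Properties
  using ( ≡ᵇ⇒≡; ≡⇒≡ᵇ; ≤ᵇ⇒≤; suc-injective; _≤?_; _<?_; <-cmp; <-irrefl; ≤-refl; ≤-reflexive; ≤-trans
        ; <-≤-trans; ≤-pred; n≤1+n; n<1+n; n≮0; ≮⇒≥; ≰⇒>; m≤n⇒m<n∨m≡n; m≤m+n; m≤n+m; m≤m*n
        ; +-assoc; +-comm; +-mono-≤; +-monoˡ-≤; +-monoʳ-≤; +-monoʳ-<; +-cancelʳ-≡; +-cancelˡ-≤
        ; +-cancelʳ-≤; *-monoˡ-≤; *-distribʳ-+; m+[n∸m]≡n; m∸n+n≡m; ⊓-monoˡ-≤; ⊓-monoʳ-≤
        ; +-distribʳ-⊓; m≥n⇒m⊓n≡n; m≤n⇒m⊓n≡m; ⌊n/2⌋≤⌈n/2⌉; ⌊n/2⌋+⌈n/2⌉≡n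
        ; +-commutativeSemigroup; module ≤-Reasoning)
open import Data.Nat.DivMod
  using (_mod_; m≡m%n+[m/n]*n; m<n⇒m%n≡m; n%n≡0; m%n%n≡m%n; %-distribˡ-+; %-remove-+ˡ; [m+kn]%n≡m%n)
open import Data.Nat.Divisibility using (n∣m*n)
open import Data.Nat.Solver using (module +-*-Solver)
open import Algebra.Properties.CommutativeSemigroup +-commutativeSemigroup using (interchange)
open import Data.Bool using (Bool; true; false; _∨_; _∧_; not; T; T?)
import Data.Bool.Properties as Bool
open import Data.Bool.Properties using (T-∨; T-∧; T-≡; T-not-≡; ∨-comm; ¬-not)
open import Data.Fin using (Fin; zero; suc; toℕ; fromℕ<)
open import Data.Fin.Patterns using (0F; 1F; 2F; 3F; 4F; 5F)
open import Data.Fin.Properties using (toℕ-fromℕ<; toℕ-injective; toℕ<n; _≟_; all?; any?)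
open import Data.Product using (Σ; _×_; ∃; _,_; proj₁; proj₂)
import Data.Product as Product
open import Data.Sum using (_⊎_; inj₁; inj₂; [_,_])
open import Data.Empty using (⊥; ⊥-elim; ⊥-elim-irr)
open import Data.Vec.Functional using (updateAt)
open import Data.Vec.Functional.Properties using (updateAt-updates; updateAt-minimal)
open import Function using (id; _∘_; const)
open import Function.Bundles using (_⇔_; mk⇔; Equivalence; _↔_; mk↔ₛ′; Inverse; Injection)
open import Function.Properties.Inverse using (↔⇒↣)
open import Relation.Nullary using (¬_; Dec; yes; no; ¬?)
open import Relation.Nullary.Decidable using (_⊎-dec_; _×-dec_; toWitness)
open import Relation.Binary.Definitions using (tri<; tri≈; tri>)
open import Relation.Binary.PropositionalEquality
  using (_≡_; _≢_; refl; trans; cong; cong₂; subst; ≢-sym; module ≡-Reasoning)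
import Relation.Binary.PropositionalEquality as ≡
open import Relation.Binary.Construct.Closure.ReflexiveTransitive using (Star; ε; _◅_)

open +-*-Solver using (solve; _:+_; _:=_)

true≢false : true ≢ false
true≢false ()

bool-cases : ∀ {A : Set} b → (b ≡ true → A) → (b ≡ false → A) → A
bool-cases true  if-true _        = if-true refl
bool-cases false _       if-false = if-false refl

T⇔⇒≡ : ∀ {a b} → T a ⇔ T b → a ≡ b
T⇔⇒≡ {false} {false} _ = refl
T⇔⇒≡ {false} {true}  a⇔b = ⊥-elim (Equivalence.from a⇔b _)
T⇔⇒≡ {true}  {false} a⇔b = ⊥-elim (Equivalence.to a⇔b _)
T⇔⇒≡ {true}  {true}  _ = refl

toℕ≡ᵇ⇔≡ : ∀ {n} {i j : Fin n} → T (toℕ i ≡ᵇ toℕ j) ⇔ i ≡ j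
toℕ≡ᵇ⇔≡ {i = i} {j} = mk⇔ (λ h → toℕ-injective (≡ᵇ⇒≡ (toℕ i) (toℕ j) h))
                          (λ i≡j → ≡⇒≡ᵇ (toℕ i) (toℕ j) (cong toℕ i≡j))

∧-not-redundant : ∀ b c → (T b → c ≡ false) → b ∧ not c ≡ b
∧-not-redundant false c       _       = refl
∧-not-redundant true  false   _       = refl
∧-not-redundant true  true    b⇒¬c   = ≡.sym (b⇒¬c _)

-- Positions on the cycle

closedAdj : (p : ℕ) → Fin p → Fin p → Bool
closedAdj p i j = (toℕ i ≡ᵇ toℕ j) ∨ cycleAdj p i j

cycleAdj-sym : ∀ p i j → cycleAdj p i j ≡ cycleAdj p j i
cycleAdj-sym p i j = ∨-comm (cycSucc p i j) (cycSucc p j i)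

≡ᵇ-sym : ∀ m n → (m ≡ᵇ n) ≡ (n ≡ᵇ m)
≡ᵇ-sym zero    zero    = refl
≡ᵇ-sym zero    (suc n) = refl
≡ᵇ-sym (suc m) zero    = refl
≡ᵇ-sym (suc m) (suc n) = ≡ᵇ-sym m n

closedAdj-sym : ∀ p i j → closedAdj p i j ≡ closedAdj p j i
closedAdj-sym p i j = cong₂ _∨_ (≡ᵇ-sym (toℕ i) (toℕ j)) (cycleAdj-sym p i j)

closedAdj-≢ : ∀ p {i j} → i ≢ j → closedAdj p i j ≡ cycleAdj p i j
closedAdj-≢ p {i} {j} i≢j = cong (_∨ cycleAdj p i j)
  (¬-not λ i≡ᵇj → i≢j (Equivalence.to toℕ≡ᵇ⇔≡ (Equivalence.from T-≡ i≡ᵇj)))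

module Rotation (p : ℕ) .{{_ : NonZero p}} where

  rotate : ℕ → Fin p → Fin p
  rotate s a = (s + toℕ a) mod p

  toℕ-rotate : ∀ s a → toℕ (rotate s a) ≡ (s + toℕ a) % p
  toℕ-rotate s a = toℕ-fromℕ< _

  [m+n%p]%p≡[m+n]%p : ∀ m n → (m + n % p) % p ≡ (m + n) % p
  [m+n%p]%p≡[m+n]%p m n = begin
    (m + n % p) % p         ≡⟨ %-distribˡ-+ m (n % p) p ⟩
    (m % p + n % p % p) % p ≡⟨ cong (λ z → (m % p + z) % p) (m%n%n≡m%n n p) ⟩
    (m % p + n % p) % p     ≡⟨ %-distribˡ-+ m n p ⟨
    (m + n) % p             ∎
    where open ≡-Reasoning

  rotate-rotate : ∀ s t a → rotate s (rotate t a) ≡ rotate (s + t) a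
  rotate-rotate s t a = toℕ-injective (begin
    toℕ (rotate s (rotate t a)) ≡⟨ toℕ-rotate s (rotate t a) ⟩
    (s + toℕ (rotate t a)) % p  ≡⟨ cong (λ z → (s + z) % p) (toℕ-rotate t a) ⟩
    (s + (t + toℕ a) % p) % p   ≡⟨ [m+n%p]%p≡[m+n]%p s (t + toℕ a) ⟩
    (s + (t + toℕ a)) % p       ≡⟨ cong (_% p) (+-assoc s t (toℕ a)) ⟨
    (s + t + toℕ a) % p         ≡⟨ toℕ-rotate (s + t) a ⟨
    toℕ (rotate (s + t) a)      ∎)
    where open ≡-Reasoning

  rotate-by-multiple : ∀ k a → rotate (k * p) a ≡ a
  rotate-by-multiple k a = toℕ-injective (begin
    toℕ (rotate (k * p) a) ≡⟨ toℕ-rotate (k * p) a ⟩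
    (k * p + toℕ a) % p    ≡⟨ %-remove-+ˡ (toℕ a) (n∣m*n k) ⟩
    toℕ a % p              ≡⟨ m<n⇒m%n≡m (toℕ<n a) ⟩
    toℕ a                  ∎)
    where open ≡-Reasoning

  -- a natural number congruent to -s modulo p
  -_ : ℕ → ℕ
  - s = s * p ∸ s

  rotate-inverseˡ : ∀ s a → rotate s (rotate (- s) a) ≡ a
  rotate-inverseˡ s a = trans (rotate-rotate s (- s) a)
    (trans (cong (λ t → rotate t a) (m+[n∸m]≡n (m≤m*n s p))) (rotate-by-multiple s a))

  rotate-inverseʳ : ∀ s a → rotate (- s) (rotate s a) ≡ a
  rotate-inverseʳ s a = trans (rotate-rotate (- s) s a)
    (trans (cong (λ t → rotate t a) (m∸n+n≡m (m≤m*n s p))) (rotate-by-multiple s a))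

  rotate-injective : ∀ s {a b} → rotate s a ≡ rotate s b → a ≡ b
  rotate-injective s {a} {b} eq =
    trans (≡.sym (rotate-inverseʳ s a)) (trans (cong (rotate (- s)) eq) (rotate-inverseʳ s b))

  rotate-reaches : ∀ a i → ∃ λ s → rotate s a ≡ i
  rotate-reaches a i = toℕ i + - toℕ a , toℕ-injective (begin
    toℕ (rotate (toℕ i + - toℕ a) a)         ≡⟨ toℕ-rotate (toℕ i + - toℕ a) a ⟩
    (toℕ i + - toℕ a + toℕ a) % p            ≡⟨ cong (_% p) (+-assoc (toℕ i) (- toℕ a) (toℕ a)) ⟩
    (toℕ i + (- toℕ a + toℕ a)) % p          ≡⟨ cong (λ t → (toℕ i + t) % p) (m∸n+n≡m (m≤m*n (toℕ a) p)) ⟩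
    (toℕ i + toℕ a * p) % p                  ≡⟨ [m+kn]%n≡m%n (toℕ i) (toℕ a) p ⟩
    toℕ i % p                                ≡⟨ m<n⇒m%n≡m (toℕ<n i) ⟩
    toℕ i                                    ∎)
    where open ≡-Reasoning

  rotate-surjective : ∀ s i → ∃ λ a → rotate s a ≡ i
  rotate-surjective s i = rotate (- s) i , rotate-inverseˡ s i

  rotate-comm : ∀ s t a → rotate s (rotate t a) ≡ rotate t (rotate s a)
  rotate-comm s t a = trans (rotate-rotate s t a)
    (trans (cong (λ u → rotate u a) (+-comm s t)) (≡.sym (rotate-rotate t s a)))

  toℕ-rotate-1 : ∀ a → (toℕ (rotate 1 a) ≡ suc (toℕ a) × suc (toℕ a) < p)
                     ⊎ (toℕ (rotate 1 a) ≡ 0 × suc (toℕ a) ≡ p)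
  toℕ-rotate-1 a with m≤n⇒m<n∨m≡n (toℕ<n a)
  ... | inj₁ a+1<p = inj₁ (trans (toℕ-rotate 1 a) (m<n⇒m%n≡m a+1<p) , a+1<p)
  ... | inj₂ a+1≡p = inj₂ (trans (toℕ-rotate 1 a) (trans (cong (_% p) a+1≡p) (n%n≡0 p)) , a+1≡p)

  cycSucc⇔rotate-1 : ∀ i j → T (cycSucc p i j) ⇔ j ≡ rotate 1 i
  cycSucc⇔rotate-1 i j = mk⇔ to from
    where
    to : T (cycSucc p i j) → j ≡ rotate 1 i
    to h with Equivalence.to T-∨ h
    ... | inj₁ i+1≡ᵇj = toℕ-injective (begin
      toℕ j           ≡⟨ i+1≡j ⟨
      suc (toℕ i)     ≡⟨ m<n⇒m%n≡m (subst (_< p) (≡.sym i+1≡j) (toℕ<n j)) ⟨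
      suc (toℕ i) % p ≡⟨ toℕ-rotate 1 i ⟨
      toℕ (rotate 1 i) ∎)
      where open ≡-Reasoning
            i+1≡j = ≡ᵇ⇒≡ (suc (toℕ i)) (toℕ j) i+1≡ᵇj
    ... | inj₂ wrap = toℕ-injective (begin
      toℕ j           ≡⟨ ≡ᵇ⇒≡ (toℕ j) 0 (proj₂ (Equivalence.to T-∧ wrap)) ⟩
      0               ≡⟨ n%n≡0 p ⟨
      p % p           ≡⟨ cong (_% p) (≡ᵇ⇒≡ (suc (toℕ i)) p (proj₁ (Equivalence.to T-∧ wrap))) ⟨
      suc (toℕ i) % p ≡⟨ toℕ-rotate 1 i ⟨
      toℕ (rotate 1 i) ∎)
      where open ≡-Reasoning
    from : j ≡ rotate 1 i → T (cycSucc p i j)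
    from refl with toℕ-rotate-1 i
    ... | inj₁ (e , _) = Equivalence.from T-∨ (inj₁ (≡⇒≡ᵇ _ _ (≡.sym e)))
    ... | inj₂ (e , i+1≡p) =
      Equivalence.from T-∨ (inj₂ (Equivalence.from T-∧ (≡⇒≡ᵇ _ _ i+1≡p , ≡⇒≡ᵇ _ 0 e)))

  cycSucc-rotate-1 : ∀ i → T (cycSucc p i (rotate 1 i))
  cycSucc-rotate-1 i = Equivalence.from (cycSucc⇔rotate-1 i _) refl

  rotate-cycSucc : ∀ s a b → cycSucc p (rotate s a) (rotate s b) ≡ cycSucc p a b
  rotate-cycSucc s a b = T⇔⇒≡ (mk⇔
    (λ h → Equivalence.from (cycSucc⇔rotate-1 a b)
             (rotate-injective s (trans (Equivalence.to (cycSucc⇔rotate-1 _ _) h) (rotate-comm 1 s a))))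
    (λ h → Equivalence.from (cycSucc⇔rotate-1 _ _)
             (trans (cong (rotate s) (Equivalence.to (cycSucc⇔rotate-1 a b) h)) (rotate-comm s 1 a))))

  rotate-cycleAdj : ∀ s a b → cycleAdj p (rotate s a) (rotate s b) ≡ cycleAdj p a b
  rotate-cycleAdj s a b = cong₂ _∨_ (rotate-cycSucc s a b) (rotate-cycSucc s b a)

  rotate-closedAdj : ∀ s a b → closedAdj p (rotate s a) (rotate s b) ≡ closedAdj p a b
  rotate-closedAdj s a b = cong₂ _∨_ rotate-≡ᵇ (rotate-cycleAdj s a b)
    where
    rotate-≡ᵇ : (toℕ (rotate s a) ≡ᵇ toℕ (rotate s b)) ≡ (toℕ a ≡ᵇ toℕ b)
    rotate-≡ᵇ = T⇔⇒≡ (mk⇔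
      (λ h → Equivalence.from toℕ≡ᵇ⇔≡ (rotate-injective s (Equivalence.to toℕ≡ᵇ⇔≡ h)))
      (λ h → Equivalence.from toℕ≡ᵇ⇔≡ (cong (rotate s) (Equivalence.to toℕ≡ᵇ⇔≡ h))))

  cycleAdj-irrefl : 1 < p → ∀ a → cycleAdj p a a ≡ false
  cycleAdj-irrefl 1<p a = ¬-not λ loop → not-successor (Equivalence.to T-∨ (Equivalence.from T-≡ loop))
    where
    not-successor : T (cycSucc p a a) ⊎ T (cycSucc p a a) → ⊥
    not-successor h with cong toℕ (Equivalence.to (cycSucc⇔rotate-1 a a) ([ id , id ] h)) | toℕ-rotate-1 a
    ... | a≡a+1 | inj₁ (e , _) = <-irrefl (trans a≡a+1 e) (n<1+n _)
    ... | a≡a+1 | inj₂ (e , a+1≡p) = <-irrefl (trans (≡.sym (cong suc (trans a≡a+1 e))) a+1≡p) 1<p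

  cycleAdj-far : ∀ a b → 1 ≤ toℕ b → 2 + toℕ b ≤ toℕ a → cycleAdj p a b ≡ false
  cycleAdj-far a b 1≤b b+2≤a =
    ¬-not λ adjacent → [ a↛b , b↛a ] (Equivalence.to T-∨ (Equivalence.from T-≡ adjacent))
    where
    a↛b : ¬ T (cycSucc p a b)
    a↛b h with cong toℕ (Equivalence.to (cycSucc⇔rotate-1 a b) h) | toℕ-rotate-1 a
    ... | b≡a+1 | inj₁ (e , _) =
      <-irrefl refl (≤-trans (≤-reflexive (≡.sym (trans b≡a+1 e))) (≤-trans (m≤n+m (toℕ b) 2) b+2≤a))
    ... | b≡a+1 | inj₂ (e , _) = <-irrefl (≡.sym (trans b≡a+1 e)) 1≤b
    b↛a : ¬ T (cycSucc p b a)
    b↛a h with cong toℕ (Equivalence.to (cycSucc⇔rotate-1 b a) h) | toℕ-rotate-1 b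
    ... | a≡b+1 | inj₁ (e , _) = <-irrefl refl (≤-trans b+2≤a (≤-reflexive (trans a≡b+1 e)))
    ... | a≡b+1 | inj₂ (_ , b+1≡p) = <-irrefl b+1≡p (≤-trans b+2≤a (≤-trans (n≤1+n _) (toℕ<n a)))

-- Clique expansions

ceAdj≡closedAdj : ∀ p ks {x y : CEVertex p ks} → x ≢ y → ceAdj p ks x y ≡ closedAdj p (proj₁ x) (proj₁ y)
ceAdj≡closedAdj p ks {i , a} {j , b} x≢y = cong (_∨ cycleAdj p i j) (∧-not-redundant _ _ distinct)
  where
  distinct : T (toℕ i ≡ᵇ toℕ j) → (toℕ a ≡ᵇ toℕ b) ≡ false
  distinct i≡ᵇj with Equivalence.to (toℕ≡ᵇ⇔≡ {i = i} {j}) i≡ᵇj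
  ... | refl = ¬-not λ a≡ᵇb →
    x≢y (cong (i ,_) (Equivalence.to toℕ≡ᵇ⇔≡ (Equivalence.from T-≡ a≡ᵇb)))

ceAdj-irrefl : ∀ p .{{_ : NonZero p}} ks → 1 < p → (x : CEVertex p ks) → ceAdj p ks x x ≡ false
ceAdj-irrefl p ks 1<p (i , a) = cong₂ _∨_ same-vertex (Rotation.cycleAdj-irrefl p 1<p i)
  where
  same-vertex : (toℕ i ≡ᵇ toℕ i) ∧ not (toℕ a ≡ᵇ toℕ a) ≡ false
  same-vertex rewrite Equivalence.to T-≡ (≡⇒≡ᵇ (toℕ i) (toℕ i) refl)
                    | Equivalence.to T-≡ (≡⇒≡ᵇ (toℕ a) (toℕ a) refl) = refl

module Fibres {p : ℕ} where

  indicator : Fin p → Fin p → ℕ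
  indicator a b with a ≟ b
  ... | yes _ = 1
  ... | no _  = 0

  indicator-≡ : ∀ {a b} → a ≡ b → indicator a b ≡ 1
  indicator-≡ {a} {b} a≡b with a ≟ b
  ... | yes _   = refl
  ... | no a≢b = ⊥-elim (a≢b a≡b)

  indicator-≢ : ∀ {a b} → a ≢ b → indicator a b ≡ 0
  indicator-≢ {a} {b} a≢b with a ≟ b
  ... | yes a≡b = ⊥-elim (a≢b a≡b)
  ... | no _    = refl

  count : (n : ℕ) → (Fin n → Fin p) → Fin p → ℕ
  count zero    c i = 0
  count (suc n) c i = indicator (c zero) i + count n (c ∘ suc) i

  rank : (n : ℕ) → (Fin n → Fin p) → Fin n → ℕ
  rank (suc n) c zero    = 0
  rank (suc n) c (suc u) = indicator (c zero) (c (suc u)) + rank n (c ∘ suc) u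

  rank<count : ∀ n c u → rank n c u < count n c (c u)
  rank<count (suc n) c zero    rewrite indicator-≡ {c zero} refl = s≤s z≤n
  rank<count (suc n) c (suc u) = +-monoʳ-< (indicator (c zero) (c (suc u))) (rank<count n (c ∘ suc) u)

  select : ∀ n (c : Fin n → Fin p) i a → .(a < count n c i) → Fin n
  select zero    c i a a<0 = ⊥-elim-irr (n≮0 a<0)
  select (suc n) c i a a<count with c zero ≟ i | a
  ... | yes _ | zero   = zero
  ... | yes _ | suc a' = suc (select n (c ∘ suc) i a' (≤-pred a<count))
  ... | no _  | a'     = suc (select n (c ∘ suc) i a' a<count)

  c∘select : ∀ n c i a .(a<count : a < count n c i) → c (select n c i a a<count) ≡ i
  c∘select zero    c i a a<0 = ⊥-elim-irr (n≮0 a<0)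
  c∘select (suc n) c i a a<count with c zero ≟ i | a
  ... | yes c0≡i | zero   = c0≡i
  ... | yes _    | suc a' = c∘select n (c ∘ suc) i a' (≤-pred a<count)
  ... | no _     | a'     = c∘select n (c ∘ suc) i a' a<count

  rank∘select : ∀ n c i a .(a<count : a < count n c i) → rank n c (select n c i a a<count) ≡ a
  rank∘select zero    c i a a<0 = ⊥-elim-irr (n≮0 a<0)
  rank∘select (suc n) c i a a<count with c zero ≟ i | a
  ... | yes c0≡i | zero   = refl
  ... | yes c0≡i | suc a' = cong₂ _+_
        (indicator-≡ (trans c0≡i (≡.sym (c∘select n (c ∘ suc) i a' (≤-pred a<count)))))
        (rank∘select n (c ∘ suc) i a' (≤-pred a<count))
  ... | no c0≢i  | a'     = cong₂ _+_
        (indicator-≢ (λ c0≡cu → c0≢i (trans c0≡cu (c∘select n (c ∘ suc) i a' a<count))))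
        (rank∘select n (c ∘ suc) i a' a<count)

  select∘rank : ∀ n c u a .(a<count : a < count n c (c u)) → a ≡ rank n c u → select n c (c u) a a<count ≡ u
  select∘rank (suc n) c zero a a<count a≡0 with c zero ≟ c zero | a
  ... | yes _ | zero   = refl
  ... | no c0≢c0 | _   = ⊥-elim (c0≢c0 refl)
  select∘rank (suc n) c (suc u) a a<count a≡rank with c zero ≟ c (suc u) | a
  ... | yes _ | suc a' = cong suc (select∘rank n (c ∘ suc) u a' (≤-pred a<count) (suc-injective a≡rank))
  ... | no _  | a'     = cong suc (select∘rank n (c ∘ suc) u a' a<count a≡rank)

  fibres-↔ : ∀ n (c : Fin n → Fin p) → Fin n ↔ Σ (Fin p) (λ i → Fin (count n c i))
  fibres-↔ n c = mk↔ₛ′ to from to∘from from∘to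
    where
    to : Fin n → Σ (Fin p) (λ i → Fin (count n c i))
    to u = c u , fromℕ< (rank<count n c u)
    from : Σ (Fin p) (λ i → Fin (count n c i)) → Fin n
    from (i , a) = select n c i (toℕ a) (toℕ<n a)
    to∘from : ∀ y → to (from y) ≡ y
    to∘from (i , a) = fibre-≡ (c∘select n c i (toℕ a) (toℕ<n a))
                               (trans (toℕ-fromℕ< _) (rank∘select n c i (toℕ a) (toℕ<n a)))
      where
      fibre-≡ : ∀ {i j} {a : Fin (count n c i)} {b : Fin (count n c j)} →
                i ≡ j → toℕ a ≡ toℕ b → (i , a) ≡ (j , b)
      fibre-≡ refl a≡b = cong (_ ,_) (toℕ-injective a≡b)
    from∘to : ∀ u → from (to u) ≡ u
    from∘to u = select∘rank n c u _ _ (toℕ-fromℕ< _)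

-- Colouring clique expansions

sumBelow : ℕ → (ℕ → ℕ) → ℕ
sumBelow zero    F = 0
sumBelow (suc n) F = sumBelow n F + F n

extend : (n : ℕ) → (Fin n → ℕ) → ℕ → ℕ
extend zero    h m       = 0
extend (suc n) h zero    = h zero
extend (suc n) h (suc m) = extend n (h ∘ suc) m

extend-toℕ : ∀ n h (i : Fin n) → extend n h (toℕ i) ≡ h i
extend-toℕ (suc n) h zero    = refl
extend-toℕ (suc n) h (suc i) = extend-toℕ n (h ∘ suc) i

sumBelow-head : ∀ n F → sumBelow (suc n) F ≡ F 0 + sumBelow n (F ∘ suc)
sumBelow-head zero    F = +-comm 0 (F 0)
sumBelow-head (suc n) F = trans (cong (_+ F (suc n)) (sumBelow-head n F)) (+-assoc (F 0) _ _)

sumFin≡sumBelow : ∀ n h → sumFin n h ≡ sumBelow n (extend n h)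
sumFin≡sumBelow zero    h = refl
sumFin≡sumBelow (suc n) h =
  trans (cong (h zero +_) (sumFin≡sumBelow n (h ∘ suc))) (≡.sym (sumBelow-head n (extend (suc n) h)))

sumBelow-cong : ∀ n F G → (∀ m → m < n → F m ≡ G m) → sumBelow n F ≡ sumBelow n G
sumBelow-cong zero    F G F≡G = refl
sumBelow-cong (suc n) F G F≡G =
  cong₂ _+_ (sumBelow-cong n F G (λ m m<n → F≡G m (≤-trans m<n (n≤1+n n)))) (F≡G n ≤-refl)

sumBelow-+ : ∀ n F G → sumBelow n (λ m → F m + G m) ≡ sumBelow n F + sumBelow n G
sumBelow-+ zero    F G = refl
sumBelow-+ (suc n) F G = trans (cong (_+ (F n + G n)) (sumBelow-+ n F G))
                               (interchange (sumBelow n F) (sumBelow n G) (F n) (G n))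

sumBelow-shift : ∀ n F → sumBelow n (F ∘ suc) + F 0 ≡ sumBelow n F + F n
sumBelow-shift zero    F = refl
sumBelow-shift (suc n) F = begin
  (sumBelow n (F ∘ suc) + F (suc n)) + F 0 ≡⟨ solve 3 (λ a b c → (a :+ b) :+ c := (a :+ c) :+ b) refl
                                                (sumBelow n (F ∘ suc)) (F (suc n)) (F 0) ⟩
  (sumBelow n (F ∘ suc) + F 0) + F (suc n) ≡⟨ cong (_+ F (suc n)) (sumBelow-shift n F) ⟩
  (sumBelow n F + F n) + F (suc n)         ∎
  where open ≡-Reasoning

sumBelow-∸ : ∀ n k F → (∀ m → m < n → F m ≤ k) → sumBelow n (λ m → k ∸ F m) + sumBelow n F ≡ n * k
sumBelow-∸ zero    k F F≤k = refl
sumBelow-∸ (suc n) k F F≤k = begin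
  (sumBelow n (λ m → k ∸ F m) + (k ∸ F n)) + (sumBelow n F + F n)
    ≡⟨ interchange (sumBelow n (λ m → k ∸ F m)) (k ∸ F n) (sumBelow n F) (F n) ⟩
  (sumBelow n (λ m → k ∸ F m) + sumBelow n F) + ((k ∸ F n) + F n)
    ≡⟨ cong₂ _+_ (sumBelow-∸ n k F (λ m m<n → F≤k m (≤-trans m<n (n≤1+n n))))
                 (m∸n+n≡m (F≤k n ≤-refl)) ⟩
  n * k + k
    ≡⟨ +-comm (n * k) k ⟩
  suc n * k ∎
  where open ≡-Reasoning

m<n<m+k⇒m%k≢n%k : ∀ k .{{_ : NonZero k}} {m n} → m < n → n < m + k → m % k ≢ n % k
m<n<m+k⇒m%k≢n%k k {m} {n} m<n n<m+k m%k≡n%k with n / k ≤? m / k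
... | yes n/k≤m/k = <-irrefl refl (<-≤-trans m<n (begin
  n                   ≡⟨ m≡m%n+[m/n]*n n k ⟩
  n % k + (n / k) * k ≤⟨ +-mono-≤ (≤-reflexive (≡.sym m%k≡n%k)) (*-monoˡ-≤ k n/k≤m/k) ⟩
  m % k + (m / k) * k ≡⟨ m≡m%n+[m/n]*n m k ⟨
  m                   ∎))
  where open ≤-Reasoning
... | no n/k≰m/k = <-irrefl refl (<-≤-trans n<m+k (begin
  m + k                         ≡⟨ cong (_+ k) (m≡m%n+[m/n]*n m k) ⟩
  m % k + (m / k) * k + k       ≡⟨ solve 3 (λ a b c → a :+ b :+ c := a :+ (c :+ b)) refl (m % k) ((m / k) * k) k ⟩
  m % k + suc (m / k) * k       ≤⟨ +-mono-≤ (≤-reflexive m%k≡n%k) (*-monoˡ-≤ k (≰⇒> n/k≰m/k)) ⟩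
  n % k + (n / k) * k           ≡⟨ m≡m%n+[m/n]*n n k ⟨
  n                             ∎))
  where open ≤-Reasoning

[o+m]%k≢[o+n]%k : ∀ k .{{_ : NonZero k}} o {m n} → m < n → n < m + k → (o + m) % k ≢ (o + n) % k
[o+m]%k≢[o+n]%k k o {m} {n} m<n n<m+k = m<n<m+k⇒m%k≢n%k k (+-monoʳ-< o m<n)
  (≤-trans (+-monoʳ-< o n<m+k) (≤-reflexive (≡.sym (+-assoc o m k))))

m⊓[n+o]≤m⊓n+o : ∀ m n o → m ⊓ (n + o) ≤ m ⊓ n + o
m⊓[n+o]≤m⊓n+o m n o =
  ≤-trans (⊓-monoˡ-≤ (n + o) (m≤m+n m o)) (≤-reflexive (≡.sym (+-distribʳ-⊓ o m n)))

-- Clique i receives the colours start i, …, start i + ks i - 1 modulo k.  Consecutive starts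
-- advance by the clique size plus part of the slack ⌊p/2⌋ k - Σ ks, spent on the gaps
-- k - ks i - ks (i+1); since the gaps sum to p k - 2 Σ ks ≥ 2 (⌊p/2⌋ k - Σ ks), all the slack is
-- spent and the colouring closes up at ⌊p/2⌋ k ≡ 0 (mod k).
module CliqueExpansionColouring
  (p : ℕ) .{{_ : NonZero p}} (k : ℕ) .{{_ : NonZero k}} (ks : Fin p → ℕ)
  (successive≤k : ∀ i j → T (cycSucc p i j) → ks i + ks j ≤ k)
  (sum≤ : sumFin p ks ≤ ⌊ p /2⌋ * k)
  where

  open Rotation p

  width : ℕ → ℕ
  width m = extend p ks (m % p)

  width-toℕ : ∀ i → width (toℕ i) ≡ ks i
  width-toℕ i = trans (cong (extend p ks) (m<n⇒m%n≡m (toℕ<n i))) (extend-toℕ p ks i)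

  width-suc : ∀ i → width (suc (toℕ i)) ≡ ks (rotate 1 i)
  width-suc i = trans (cong (extend p ks) (≡.sym (toℕ-rotate 1 i))) (extend-toℕ p ks (rotate 1 i))

  width-p : width p ≡ width 0
  width-p = cong (extend p ks) (trans (n%n≡0 p) (≡.sym (m<n⇒m%n≡m (>-nonZero⁻¹ p))))

  width+width≤k : ∀ m → m < p → width m + width (suc m) ≤ k
  width+width≤k m m<p = begin
    width m + width (suc m)             ≡⟨ cong (λ j → width j + width (suc j)) (toℕ-fromℕ< m<p) ⟨
    width (toℕ i) + width (suc (toℕ i)) ≡⟨ cong₂ _+_ (width-toℕ i) (width-suc i) ⟩
    ks i + ks (rotate 1 i)              ≤⟨ successive≤k i (rotate 1 i) (cycSucc-rotate-1 i) ⟩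
    k                                   ∎
    where open ≤-Reasoning
          i = fromℕ< m<p

  ks≤k : ∀ i → ks i ≤ k
  ks≤k i = ≤-trans (m≤m+n (ks i) _) (successive≤k i (rotate 1 i) (cycSucc-rotate-1 i))

  total : ℕ
  total = sumBelow p width

  total≡sumFin : total ≡ sumFin p ks
  total≡sumFin = trans (sumBelow-cong p width (extend p ks) (λ m m<p → cong (extend p ks) (m<n⇒m%n≡m m<p)))
                       (≡.sym (sumFin≡sumBelow p ks))

  gap : ℕ → ℕ
  gap m = k ∸ (width m + width (suc m))

  gaps : ℕ → ℕ
  gaps i = sumBelow i gap

  slack : ℕ
  slack = ⌊ p /2⌋ * k ∸ total

  start : ℕ → ℕ
  start i = sumBelow i width + slack ⊓ gaps i

  gaps+2total≡p*k : gaps p + (total + total) ≡ p * k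
  gaps+2total≡p*k = begin
    gaps p + (total + total)                              ≡⟨ cong (λ t → gaps p + (total + t)) shifted-total ⟨
    gaps p + (total + sumBelow p (width ∘ suc))           ≡⟨ cong (gaps p +_) (sumBelow-+ p width (width ∘ suc)) ⟨
    gaps p + sumBelow p (λ m → width m + width (suc m))   ≡⟨ sumBelow-∸ p k _ width+width≤k ⟩
    p * k                                                 ∎
    where
    open ≡-Reasoning
    shifted-total : sumBelow p (width ∘ suc) ≡ total
    shifted-total = +-cancelʳ-≡ (width 0) _ _ (trans (sumBelow-shift p width) (cong (total +_) width-p))

  slack+total≡ : slack + total ≡ ⌊ p /2⌋ * k
  slack+total≡ = m∸n+n≡m (≤-trans (≤-reflexive total≡sumFin) sum≤)

  slack≤gaps : slack ≤ gaps p
  slack≤gaps = +-cancelʳ-≤ (total + total) slack (gaps p) (begin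
    slack + (total + total)          ≡⟨ +-assoc slack total total ⟨
    slack + total + total            ≡⟨ cong (_+ total) slack+total≡ ⟩
    ⌊ p /2⌋ * k + total              ≤⟨ +-monoʳ-≤ (⌊ p /2⌋ * k) (≤-trans (≤-reflexive total≡sumFin) sum≤) ⟩
    ⌊ p /2⌋ * k + ⌊ p /2⌋ * k        ≡⟨ *-distribʳ-+ k ⌊ p /2⌋ ⌊ p /2⌋ ⟨
    (⌊ p /2⌋ + ⌊ p /2⌋) * k          ≤⟨ *-monoˡ-≤ k ⌊p/2⌋+⌊p/2⌋≤p ⟩
    p * k                            ≡⟨ gaps+2total≡p*k ⟨
    gaps p + (total + total)         ∎)
    where
    open ≤-Reasoning
    ⌊p/2⌋+⌊p/2⌋≤p : ⌊ p /2⌋ + ⌊ p /2⌋ ≤ p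
    ⌊p/2⌋+⌊p/2⌋≤p =
      ≤-trans (+-monoʳ-≤ ⌊ p /2⌋ (⌊n/2⌋≤⌈n/2⌉ p)) (≤-reflexive (⌊n/2⌋+⌈n/2⌉≡n p))

  start-0 : start 0 ≡ 0
  start-0 = m≥n⇒m⊓n≡n z≤n

  start-p : start p ≡ ⌊ p /2⌋ * k
  start-p = trans (cong (total +_) (m≤n⇒m⊓n≡m slack≤gaps)) (trans (+-comm total slack) slack+total≡)

  successive-starts : ∀ i a b → i < p → a < width i → b < width (suc i) →
                      (start i + a) % k ≢ (start (suc i) + b) % k
  successive-starts i a b i<p a<width b<width eq =
    [o+m]%k≢[o+n]%k k (sumBelow i width + spent) a<c c<a+k (trans eq (cong (_% k) regroup))
    where
    spent = slack ⊓ gaps i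
    spent′ = slack ⊓ (gaps i + gap i)
    step = spent′ ∸ spent
    spent+step≡ : spent + step ≡ spent′
    spent+step≡ = m+[n∸m]≡n (⊓-monoʳ-≤ slack (m≤m+n (gaps i) (gap i)))
    step≤gap : step ≤ gap i
    step≤gap = +-cancelˡ-≤ spent step (gap i)
      (≤-trans (≤-reflexive spent+step≡) (m⊓[n+o]≤m⊓n+o slack (gaps i) (gap i)))
    c = width i + step + b
    regroup : sumBelow i width + width i + spent′ + b ≡ sumBelow i width + spent + c
    regroup = trans (cong (λ z → sumBelow i width + width i + z + b) (≡.sym spent+step≡))
                    (solve 5 (λ s a f e b → s :+ f :+ (a :+ e) :+ b := s :+ a :+ (f :+ e :+ b)) refl
                       (sumBelow i width) spent (width i) step b)
    a<c : a < c
    a<c = ≤-trans a<width (≤-trans (m≤m+n (width i) step) (m≤m+n (width i + step) b))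
    c<a+k : c < a + k
    c<a+k = begin-strict
      width i + step + b                     ≤⟨ +-monoˡ-≤ b (+-monoʳ-≤ (width i) step≤gap) ⟩
      width i + gap i + b                    <⟨ +-monoʳ-< (width i + gap i) b<width ⟩
      width i + gap i + width (suc i)        ≡⟨ solve 3 (λ a b c → a :+ b :+ c := b :+ (a :+ c)) refl
                                                   (width i) (gap i) (width (suc i)) ⟩
      gap i + (width i + width (suc i))      ≡⟨ m∸n+n≡m (width+width≤k i i<p) ⟩
      k                                      ≤⟨ m≤n+m k a ⟩
      a + k                                  ∎
      where open ≤-Reasoning

  colour : CEVertex p ks → Fin k
  colour (i , a) = (start (toℕ i) + toℕ a) mod k

  toℕ-colour : ∀ x → toℕ (colour x) ≡ (start (toℕ (proj₁ x)) + toℕ (proj₂ x)) % k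
  toℕ-colour x = toℕ-fromℕ< _

  start-rotate-1 : ∀ i b → (start (toℕ (rotate 1 i)) + b) % k ≡ (start (suc (toℕ i)) + b) % k
  start-rotate-1 i b with toℕ-rotate-1 i
  ... | inj₁ (e , _)    = cong (λ j → (start j + b) % k) e
  ... | inj₂ (e , i+1≡p) = begin
    (start (toℕ (rotate 1 i)) + b) % k ≡⟨ cong (λ j → (start j + b) % k) e ⟩
    (start 0 + b) % k                  ≡⟨ cong (λ s → (s + b) % k) start-0 ⟩
    b % k                              ≡⟨ %-remove-+ˡ b (n∣m*n ⌊ p /2⌋) ⟨
    (⌊ p /2⌋ * k + b) % k              ≡⟨ cong (λ s → (s + b) % k) (trans (cong start i+1≡p) start-p) ⟨
    (start (suc (toℕ i)) + b) % k      ∎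
    where open ≡-Reasoning

  colour-successive : ∀ i j a b → T (cycSucc p i j) → colour (i , a) ≢ colour (j , b)
  colour-successive i j a b i→j same = successive-starts (toℕ i) (toℕ a) (toℕ b) (toℕ<n i)
    (subst (toℕ a <_) (≡.sym (width-toℕ i)) (toℕ<n a))
    (subst (toℕ b <_) (≡.sym (trans (width-suc i) (cong ks (≡.sym j≡i+1)))) (toℕ<n b))
    (begin
      (start (toℕ i) + toℕ a) % k             ≡⟨ toℕ-colour (i , a) ⟨
      toℕ (colour (i , a))                     ≡⟨ cong toℕ same ⟩
      toℕ (colour (j , b))                     ≡⟨ toℕ-colour (j , b) ⟩
      (start (toℕ j) + toℕ b) % k             ≡⟨ cong (λ j → (start (toℕ j) + toℕ b) % k) j≡i+1 ⟩
      (start (toℕ (rotate 1 i)) + toℕ b) % k  ≡⟨ start-rotate-1 i (toℕ b) ⟩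
      (start (suc (toℕ i)) + toℕ b) % k       ∎)
    where
    open ≡-Reasoning
    j≡i+1 = Equivalence.to (cycSucc⇔rotate-1 i j) i→j

  colour-within-clique : ∀ i (a b : Fin (ks i)) → toℕ a < toℕ b → colour (i , a) ≢ colour (i , b)
  colour-within-clique i a b a<b same = [o+m]%k≢[o+n]%k k (start (toℕ i)) a<b
    (≤-trans (toℕ<n b) (≤-trans (ks≤k i) (m≤n+m k (toℕ a))))
    (trans (≡.sym (toℕ-colour (i , a))) (trans (cong toℕ same) (toℕ-colour (i , b))))

  colour-proper : ∀ x y → T (ceAdj p ks x y) → colour x ≢ colour y
  colour-proper (i , a) (j , b) x~y with Equivalence.to T-∨ x~y
  ... | inj₂ i~j = [ (λ i→j → colour-successive i j a b i→j)
                   , (λ j→i → ≢-sym (colour-successive j i b a j→i)) ] (Equivalence.to T-∨ i~j)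
  ... | inj₁ same-clique with Equivalence.to T-∧ same-clique
  ... | i≡ᵇj , a≢ᵇb with Equivalence.to (toℕ≡ᵇ⇔≡ {i = i} {j}) i≡ᵇj
  ... | refl with <-cmp (toℕ a) (toℕ b)
  ... | tri< a<b _ _ = colour-within-clique i a b a<b
  ... | tri≈ _ a≡b _ = ⊥-elim (subst T (Equivalence.to T-not-≡ a≢ᵇb) (≡⇒≡ᵇ _ _ a≡b))
  ... | tri> _ _ b<a = ≢-sym (colour-within-clique i b a b<a)

IsoCE⇒Colorable : ∀ G {p ks k} → IsoCE G p ks →
                  (Σ (CEVertex p ks → Fin k) λ c → ∀ x y → T (ceAdj p ks x y) → c x ≢ c y) → Colorable G k
IsoCE⇒Colorable G (φ , adj≡ceAdj) (c , c-proper) =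
  c ∘ Inverse.to φ , λ u v uv → c-proper _ _ (Equivalence.from T-≡ (trans (≡.sym (adj≡ceAdj u v)) uv))

-- Claw- and bull-free graphs

-- pairs that every map realising the adjacency pattern R keeps apart
Separated : ∀ {m} → (Fin m → Fin m → Bool) → Fin m → Fin m → Set
Separated R x y = x ≡ y ⊎ T (R x y) ⊎ ∃ λ z → R x z ≢ R y z

separated? : ∀ {m} (R : Fin m → Fin m → Bool) x y → Dec (Separated R x y)
separated? R x y = x ≟ y ⊎-dec T? (R x y) ⊎-dec any? λ z → ¬? (R x z Bool.≟ R y z)

bull-separated : ∀ x y → Separated bull x y
bull-separated = toWitness {a? = all? λ x → all? λ y → separated? bull x y} _

module _ (G : Graph) where

  flip-adj : ∀ {u v b} → adj G u v ≡ b → adj G v u ≡ b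
  flip-adj {u} {v} uv≡b = trans (Graph.sym G v u) uv≡b

  adj⇒≢ : ∀ {u v} → adj G u v ≡ true → u ≢ v
  adj⇒≢ {u} uv refl = true≢false (trans (≡.sym uv) (irrefl G u))

  told-apart : ∀ {w a b} → adj G w a ≡ true → adj G w b ≡ false → a ≢ b
  told-apart wa wb refl = true≢false (trans (≡.sym wa) wb)

  inducedCopy : ∀ {m} (R : Fin m → Fin m → Bool) (h : Fin m → Vertex G) →
                (∀ x y → adj G (h x) (h y) ≡ R x y) → (∀ x y → Separated R x y ⊎ h x ≢ h y) →
                InducedCopy m R G
  inducedCopy R h h-adj separated = h , (λ {x} {y} → injective x y) , h-adj
    where
    injective : ∀ x y → h x ≡ h y → x ≡ y
    injective x y hx≡hy with separated x y
    ... | inj₂ hx≢hy                = ⊥-elim (hx≢hy hx≡hy)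
    ... | inj₁ (inj₁ x≡y)           = x≡y
    ... | inj₁ (inj₂ (inj₁ x~y))    = ⊥-elim (adj⇒≢ (trans (h-adj x y) (Equivalence.to T-≡ x~y)) hx≡hy)
    ... | inj₁ (inj₂ (inj₂ (z , Rxz≢Ryz))) =
          ⊥-elim (Rxz≢Ryz (trans (≡.sym (h-adj x z)) (trans (cong (λ v → adj G v (h z)) hx≡hy) (h-adj y z))))

module ClawBullFree (G : Graph) (bull-free : ¬ InducedCopy 5 bull G) (claw-free : ¬ InducedCopy 4 claw G) where

  V : Set
  V = Vertex G

  no-claw : (c l₁ l₂ l₃ : V) → l₁ ≢ l₂ → l₁ ≢ l₃ → l₂ ≢ l₃ →
            adj G c l₁ ≡ true → adj G c l₂ ≡ true → adj G c l₃ ≡ true →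
            adj G l₁ l₂ ≡ false → adj G l₁ l₃ ≡ false → adj G l₂ l₃ ≡ false → ⊥
  no-claw c l₁ l₂ l₃ l₁≢l₂ l₁≢l₃ l₂≢l₃ c₁ c₂ c₃ n₁₂ n₁₃ n₂₃ =
    claw-free (inducedCopy G claw h h-adj apart)
    where
    h : Fin 4 → V
    h 0F = c
    h 1F = l₁
    h 2F = l₂
    h 3F = l₃
    h-adj : ∀ x y → adj G (h x) (h y) ≡ claw x y
    h-adj 0F 0F = irrefl G c
    h-adj 0F 1F = c₁
    h-adj 0F 2F = c₂
    h-adj 0F 3F = c₃
    h-adj 1F 0F = flip-adj G c₁
    h-adj 1F 1F = irrefl G l₁
    h-adj 1F 2F = n₁₂
    h-adj 1F 3F = n₁₃
    h-adj 2F 0F = flip-adj G c₂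
    h-adj 2F 1F = flip-adj G n₁₂
    h-adj 2F 2F = irrefl G l₂
    h-adj 2F 3F = n₂₃
    h-adj 3F 0F = flip-adj G c₃
    h-adj 3F 1F = flip-adj G n₁₃
    h-adj 3F 2F = flip-adj G n₂₃
    h-adj 3F 3F = irrefl G l₃
    -- the leaves of a claw are twins, so their images must be given as distinct
    apart : ∀ x y → Separated claw x y ⊎ h x ≢ h y
    apart 1F 2F = inj₂ l₁≢l₂
    apart 1F 3F = inj₂ l₁≢l₃
    apart 2F 1F = inj₂ (≢-sym l₁≢l₂)
    apart 2F 3F = inj₂ l₂≢l₃
    apart 3F 1F = inj₂ (≢-sym l₁≢l₃)
    apart 3F 2F = inj₂ (≢-sym l₂≢l₃)
    apart 0F 0F = inj₁ (inj₁ refl)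
    apart 1F 1F = inj₁ (inj₁ refl)
    apart 2F 2F = inj₁ (inj₁ refl)
    apart 3F 3F = inj₁ (inj₁ refl)
    apart 0F (suc _) = inj₁ (inj₂ (inj₁ _))
    apart (suc _) 0F = inj₁ (inj₂ (inj₁ _))

  no-bull : (v₁ v₂ v₃ v₄ v₅ : V) →
            adj G v₁ v₂ ≡ true → adj G v₂ v₃ ≡ true → adj G v₃ v₄ ≡ true → adj G v₄ v₅ ≡ true →
            adj G v₂ v₄ ≡ true → adj G v₁ v₃ ≡ false → adj G v₁ v₄ ≡ false → adj G v₁ v₅ ≡ false →
            adj G v₂ v₅ ≡ false → adj G v₃ v₅ ≡ false → ⊥
  no-bull v₁ v₂ v₃ v₄ v₅ e₁₂ e₂₃ e₃₄ e₄₅ e₂₄ n₁₃ n₁₄ n₁₅ n₂₅ n₃₅ =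
    bull-free (inducedCopy G bull h h-adj (λ x y → inj₁ (bull-separated x y)))
    where
    h : Fin 5 → V
    h 0F = v₁
    h 1F = v₂
    h 2F = v₃
    h 3F = v₄
    h 4F = v₅
    h-adj : ∀ x y → adj G (h x) (h y) ≡ bull x y
    h-adj 0F 0F = irrefl G v₁
    h-adj 0F 1F = e₁₂
    h-adj 0F 2F = n₁₃
    h-adj 0F 3F = n₁₄
    h-adj 0F 4F = n₁₅
    h-adj 1F 0F = flip-adj G e₁₂
    h-adj 1F 1F = irrefl G v₂
    h-adj 1F 2F = e₂₃
    h-adj 1F 3F = e₂₄
    h-adj 1F 4F = n₂₅
    h-adj 2F 0F = flip-adj G n₁₃
    h-adj 2F 1F = flip-adj G e₂₃
    h-adj 2F 2F = irrefl G v₃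
    h-adj 2F 3F = e₃₄
    h-adj 2F 4F = n₃₅
    h-adj 3F 0F = flip-adj G n₁₄
    h-adj 3F 1F = flip-adj G e₂₄
    h-adj 3F 2F = flip-adj G e₃₄
    h-adj 3F 3F = irrefl G v₄
    h-adj 3F 4F = e₄₅
    h-adj 4F 0F = flip-adj G n₁₅
    h-adj 4F 1F = flip-adj G n₂₅
    h-adj 4F 2F = flip-adj G n₃₅
    h-adj 4F 3F = flip-adj G e₄₅
    h-adj 4F 4F = irrefl G v₅

  module AroundCycle (q : ℕ) where

    p : ℕ
    p = 7 + q

    open Rotation p

    pattern 6+_ m = suc (suc (suc (suc (suc (suc m)))))

    InducedCycle : (Fin p → V) → Set
    InducedCycle g = ∀ a b → adj G (g a) (g b) ≡ cycleAdj p a b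

    OffCycle : (Fin p → V) → V → Set
    OffCycle g x = ∀ m → x ≢ g m

    Clone : (Fin p → V) → V → Fin p → Set
    Clone g x j = ∀ m → adj G x (g m) ≡ closedAdj p j m

    cycle-≢ : ∀ {g} → InducedCycle g → ∀ w {a b} →
              cycleAdj p w a ≡ true → cycleAdj p w b ≡ false → g a ≢ g b
    cycle-≢ cycle w wa wb = told-apart G (trans (cycle w _) wa) (trans (cycle w _) wb)

    beyond-5 : ∀ m b → T (1 ≤ᵇ toℕ b) → T (toℕ b ≤ᵇ 4) → cycleAdj p (6+ m) b ≡ false
    beyond-5 m b 1≤b b≤4 = cycleAdj-far (6+ m) b (≤ᵇ⇒≤ 1 (toℕ b) 1≤b)
      (≤-trans (+-monoʳ-≤ 2 (≤ᵇ⇒≤ (toℕ b) 4 b≤4)) (m≤m+n 6 (toℕ m)))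

    rotate-InducedCycle : ∀ {g} → InducedCycle g → ∀ s → InducedCycle (g ∘ rotate s)
    rotate-InducedCycle cycle s a b = trans (cycle (rotate s a) (rotate s b)) (rotate-cycleAdj s a b)

    Clone-rotated : ∀ {g x} s {a} → Clone g x (rotate s a) → Clone (g ∘ rotate s) x a
    Clone-rotated s {a} clone b = trans (clone (rotate s b)) (rotate-closedAdj s a b)

    Clone-unrotated : ∀ {g x} s {a} → Clone (g ∘ rotate s) x a → Clone g x (rotate s a)
    Clone-unrotated {g} {x} s {a} clone m with rotate-surjective s m
    ... | b , refl = trans (clone b) (≡.sym (rotate-closedAdj s a b))

    clone-at-3 : ∀ {g x} → InducedCycle g →
                 adj G x (g 2F) ≡ true → adj G x (g 3F) ≡ true → adj G x (g 4F) ≡ true → Clone g x 3F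
    clone-at-3 {g} {x} cycle x₂ x₃ x₄ = clone
      where
      ¬x₁ : adj G x (g 1F) ≡ false
      ¬x₁ = ¬-not λ x₁ → bool-cases (adj G x (g 5F))
        (λ x₅ → no-claw x (g 1F) (g 3F) (g 5F) (cycle-≢ cycle 0F refl refl) (cycle-≢ cycle 0F refl refl)
                  (cycle-≢ cycle 2F refl refl) x₁ x₃ x₅ (cycle 1F 3F) (cycle 1F 5F) (cycle 3F 5F))
        (λ ¬x₅ → no-bull (g 1F) x (g 3F) (g 4F) (g 5F) (flip-adj G x₁) x₃ (cycle 3F 4F) (cycle 4F 5F) x₄
                   (cycle 1F 3F) (cycle 1F 4F) (cycle 1F 5F) ¬x₅ (cycle 3F 5F))
      ¬x₅ : adj G x (g 5F) ≡ false
      ¬x₅ = ¬-not λ x₅ → no-bull (g 5F) x (g 3F) (g 2F) (g 1F) (flip-adj G x₅) x₃ (cycle 3F 2F) (cycle 2F 1F) x₂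
                           (cycle 5F 3F) (cycle 5F 2F) (cycle 5F 1F) ¬x₁ (cycle 3F 1F)
      clone : Clone g x 3F
      clone 0F = ¬-not λ x₀ → no-claw x (g 0F) (g 2F) (g 4F) (≢-sym (cycle-≢ cycle 3F refl refl))
                   (cycle-≢ cycle 1F refl refl) (cycle-≢ cycle 1F refl refl) x₀ x₂ x₄
                   (cycle 0F 2F) (cycle 0F 4F) (cycle 2F 4F)
      clone 1F = ¬x₁
      clone 2F = x₂
      clone 3F = x₃
      clone 4F = x₄
      clone 5F = ¬x₅
      clone m@(6+ m') = trans (¬-not λ xm → no-claw x (g m) (g 2F) (g 4F)
        (≢-sym (cycle-≢ cycle 3F refl 3≁m)) (≢-sym (cycle-≢ cycle 3F refl 3≁m)) (cycle-≢ cycle 1F refl refl)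
        xm x₂ x₄ (trans (cycle m 2F) (beyond-5 m' 2F _ _)) (trans (cycle m 4F) (beyond-5 m' 4F _ _)) (cycle 2F 4F))
        (≡.sym 3≁m)
        where
        3≁m : cycleAdj p 3F m ≡ false
        3≁m = trans (cycleAdj-sym p 3F m) (beyond-5 m' 3F _ _)

    consecutive⇒clone : ∀ {g x} → InducedCycle g → ∀ j →
                        adj G x (g j) ≡ true → adj G x (g (rotate 1 j)) ≡ true → adj G x (g (rotate 2 j)) ≡ true →
                        Clone g x (rotate 1 j)
    consecutive⇒clone {g} {x} cycle j xj xj+1 xj+2 with rotate-reaches 2F j
    ... | s , refl = subst (Clone g x) (≡.sym (rotate-comm 1 s 2F))
      (Clone-unrotated s (clone-at-3 (rotate-InducedCycle cycle s) xj (adjacent-to 1 xj+1) (adjacent-to 2 xj+2)))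
      where
      -- for p = 7 + q, rotate t 2F computes to the position 2 + t
      adjacent-to : ∀ t → adj G x (g (rotate t (rotate s 2F))) ≡ true → adj G x (g (rotate s (rotate t 2F))) ≡ true
      adjacent-to t = subst (λ m → adj G x (g m) ≡ true) (rotate-comm t s 2F)

    neighbour⇒clone : ∀ {f x i} → InducedCycle f → OffCycle f x → adj G x (f i) ≡ true → ∃ (Clone f x)
    neighbour⇒clone {f} {x} {i} cycle off xi with rotate-reaches 3F i
    ... | s , refl = Product.map (rotate s) (Clone-unrotated s) clone-in-frame
      where
      g = f ∘ rotate s
      cycle′ = rotate-InducedCycle cycle s
      clone-in-frame : ∃ (Clone g x)
      clone-in-frame = bool-cases (adj G x (g 2F))
        (λ x₂ → bool-cases (adj G x (g 4F))
          (λ x₄ → 3F , consecutive⇒clone cycle′ 2F x₂ xi x₄)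
          (λ ¬x₄ → let x₁ = ¬-not λ ¬x₁ → no-bull (g 1F) (g 2F) x (g 3F) (g 4F) (cycle′ 1F 2F) (flip-adj G x₂) xi
                                             (cycle′ 3F 4F) (cycle′ 2F 3F) (flip-adj G ¬x₁) (cycle′ 1F 3F)
                                             (cycle′ 1F 4F) (cycle′ 2F 4F) ¬x₄
                   in 2F , consecutive⇒clone cycle′ 1F x₁ x₂ xi))
        (λ ¬x₂ → bool-cases (adj G x (g 4F))
          (λ x₄ → let x₅ = ¬-not λ ¬x₅ → no-bull (g 2F) (g 3F) x (g 4F) (g 5F) (cycle′ 2F 3F) (flip-adj G xi) x₄
                                             (cycle′ 4F 5F) (cycle′ 3F 4F) (flip-adj G ¬x₂) (cycle′ 2F 4F)
                                             (cycle′ 2F 5F) (cycle′ 3F 5F) ¬x₅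
                  in 4F , consecutive⇒clone cycle′ 3F xi x₄ x₅)
          (λ ¬x₄ → ⊥-elim (no-claw (g 3F) x (g 2F) (g 4F) (off (rotate s 2F)) (off (rotate s 4F))
                             (cycle-≢ cycle′ 1F refl refl) (flip-adj G xi) (cycle′ 3F 2F) (cycle′ 3F 4F)
                             ¬x₂ ¬x₄ (cycle′ 2F 4F))))

    replace-InducedCycle : ∀ {g u} → InducedCycle g → ∀ μ → Clone g u μ →
                           InducedCycle (updateAt g μ (const u))
    replace-InducedCycle {g} {u} cycle μ u-clone a b with a ≟ μ | b ≟ μ
    ... | yes refl | yes refl = trans (cong₂ (adj G) (updateAt-updates a g) (updateAt-updates a g))
                                      (trans (irrefl G u) (≡.sym (cycleAdj-irrefl (s≤s (s≤s z≤n)) a)))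
    ... | yes refl | no b≢μ  = trans (cong₂ (adj G) (updateAt-updates a g) (updateAt-minimal b a g b≢μ))
                                     (trans (u-clone b) (closedAdj-≢ p (≢-sym b≢μ)))
    ... | no a≢μ  | yes refl = trans (cong₂ (adj G) (updateAt-minimal a b g a≢μ) (updateAt-updates b g))
                                     (flip-adj G (trans (u-clone a)
                                       (trans (closedAdj-≢ p (≢-sym a≢μ)) (cycleAdj-sym p b a))))
    ... | no a≢μ  | no b≢μ  = trans (cong₂ (adj G) (updateAt-minimal a μ g a≢μ) (updateAt-minimal b μ g b≢μ))
                                    (cycle a b)

    clones-adjacency-at-3 : ∀ {g u v} → InducedCycle g → u ≢ v → Clone g v 3F →
                            ∀ μ → Clone g u μ → adj G u v ≡ closedAdj p μ 3F
    clones-adjacency-at-3 {g} {u} {v} cycle u≢v v-clone = adjacency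
      where
      -- putting u in place of g μ gives an induced cycle on which v is still a clone at 3
      far : ∀ μ → Clone g u μ → μ ≢ 2F → μ ≢ 3F → μ ≢ 4F →
            closedAdj p 3F μ ≡ false → adj G u v ≡ false
      far μ u-clone μ≢2 μ≢3 μ≢4 3≁μ = ¬-not λ uv → true≢false (begin
        true                            ≡⟨ flip-adj G uv ⟨
        adj G v u                       ≡⟨ cong (adj G v) (updateAt-updates μ g) ⟨
        adj G v (g′ μ)                  ≡⟨ clone-at-3 (replace-InducedCycle cycle μ u-clone)
                                             (kept 2F (≢-sym μ≢2)) (kept 3F (≢-sym μ≢3)) (kept 4F (≢-sym μ≢4)) μ ⟩
        closedAdj p 3F μ                ≡⟨ 3≁μ ⟩
        false                           ∎)
        where
        open ≡-Reasoning
        g′ = updateAt g μ (const u)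
        kept : ∀ m → m ≢ μ → adj G v (g′ m) ≡ closedAdj p 3F m
        kept m m≢μ = trans (cong (adj G v) (updateAt-minimal m μ g m≢μ)) (v-clone m)
      adjacency : ∀ μ → Clone g u μ → adj G u v ≡ closedAdj p μ 3F
      adjacency 0F u-clone = far 0F u-clone (λ ()) (λ ()) (λ ()) refl
      adjacency 1F u-clone = far 1F u-clone (λ ()) (λ ()) (λ ()) refl
      adjacency 2F u-clone = ¬-not λ ¬uv → no-bull u (g 3F) v (g 4F) (g 5F) (u-clone 3F) (flip-adj G (v-clone 3F))
        (v-clone 4F) (cycle 4F 5F) (cycle 3F 4F) ¬uv (u-clone 4F) (u-clone 5F) (cycle 3F 5F) (v-clone 5F)
      adjacency 3F u-clone = ¬-not λ ¬uv → no-claw (g 2F) (g 1F) u v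
        (≢-sym (told-apart G (flip-adj G (u-clone 3F)) (cycle 3F 1F)))
        (≢-sym (told-apart G (flip-adj G (v-clone 3F)) (cycle 3F 1F))) u≢v
        (cycle 2F 1F) (flip-adj G (u-clone 2F)) (flip-adj G (v-clone 2F))
        (flip-adj G (u-clone 1F)) (flip-adj G (v-clone 1F)) ¬uv
      adjacency 4F u-clone = ¬-not λ ¬uv → no-bull u (g 3F) v (g 2F) (g 1F) (u-clone 3F) (flip-adj G (v-clone 3F))
        (v-clone 2F) (cycle 2F 1F) (cycle 3F 2F) ¬uv (u-clone 2F) (u-clone 1F) (cycle 3F 1F) (v-clone 1F)
      adjacency 5F u-clone = far 5F u-clone (λ ()) (λ ()) (λ ()) refl
      adjacency μ@(6+ μ') u-clone =
        trans (far μ u-clone (λ ()) (λ ()) (λ ()) 3≁μ) (≡.sym (trans (closedAdj-sym p μ 3F) 3≁μ))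
        where
        3≁μ : closedAdj p 3F μ ≡ false
        3≁μ = trans (cycleAdj-sym p 3F μ) (beyond-5 μ' 3F _ _)

    clone-adjacency : ∀ {g u v i j} → InducedCycle g → u ≢ v → Clone g u i → Clone g v j →
                      adj G u v ≡ closedAdj p i j
    clone-adjacency {g} {u} {v} {i} {j} cycle u≢v u-clone v-clone with rotate-reaches 3F j
    ... | s , refl with rotate-surjective s i
    ... | μ , refl = trans (clones-adjacency-at-3 (rotate-InducedCycle cycle s) u≢v (Clone-rotated s v-clone)
                              μ (Clone-rotated s u-clone))
                           (≡.sym (rotate-closedAdj s μ 3F))

    Member : (Fin p → V) → V → Fin p → Set
    Member f v j = v ≡ f j ⊎ (OffCycle f v × Clone f v j)

    module _ {f : Fin p → V} (cycle : InducedCycle f) where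

      member-step : ∀ {u w} → ∃ (Member f u) → adj G u w ≡ true → ∃ (Member f w)
      member-step {u} {w} (j , u∈j) uw with any? (λ m → w ≟ f m)
      ... | yes (m , w≡fm) = m , inj₁ w≡fm
      ... | no w∉f with any? (λ m → adj G w (f m) Bool.≟ true)
      ...   | yes (m , wm) = Product.map₂ (λ w-clone → inj₂ (off , w-clone)) (neighbour⇒clone cycle off wm)
        where off : OffCycle f w
              off m w≡fm = w∉f (m , w≡fm)
      ...   | no no-neighbour = ⊥-elim (attached u∈j)
        where
        w≁ : ∀ m → adj G w (f m) ≡ false
        w≁ m = ¬-not λ wm → no-neighbour (m , wm)
        attached : Member f u j → ⊥
        attached (inj₁ refl) = true≢false (trans (≡.sym (flip-adj G uw)) (w≁ j))
        attached (inj₂ (_ , u-clone)) with rotate-reaches 3F j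
        ... | s , refl = no-claw u (f (rotate s 2F)) (f (rotate s 4F)) w
          (cycle-≢ (rotate-InducedCycle cycle s) 1F refl refl) (λ e → w∉f (_ , ≡.sym e)) (λ e → w∉f (_ , ≡.sym e))
          (Clone-rotated s u-clone 2F) (Clone-rotated s u-clone 4F) uw
          (rotate-InducedCycle cycle s 2F 4F) (flip-adj G (w≁ _)) (flip-adj G (w≁ _))

      member-walk : ∀ {u v} → ∃ (Member f u) → Star (Edge G) u v → ∃ (Member f v)
      member-walk u∈ ε        = u∈
      member-walk u∈ (e ◅ es) = member-walk (member-step u∈ e) es

      member-adjacency : ∀ {u v i j} → Member f u i → Member f v j → u ≢ v → adj G u v ≡ closedAdj p i j
      member-adjacency {i = i} {j} (inj₁ refl) (inj₁ refl) u≢v =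
        trans (cycle i j) (≡.sym (closedAdj-≢ p (λ i≡j → u≢v (cong f i≡j))))
      member-adjacency {i = i} {j} (inj₁ refl) (inj₂ (_ , v-clone)) _ =
        trans (flip-adj G (v-clone i)) (closedAdj-sym p j i)
      member-adjacency {i = i} {j} (inj₂ (_ , u-clone)) (inj₁ refl) _ = u-clone j
      member-adjacency {i = i} {j} (inj₂ (_ , u-clone)) (inj₂ (_ , v-clone)) u≢v =
        clone-adjacency {i = i} {j} cycle u≢v u-clone v-clone

    open Fibres

    cliqueExpansion : Connected G → HasInducedCycle G p →
                      Σ (Fin p → ℕ) λ ks → (∀ i → 1 ≤ ks i) × IsoCE G p ks
    cliqueExpansion connected (f , f-injective , cycle) = ks , ks-positive , φ , adj≡ceAdj
      where
      membership : ∀ v → ∃ (Member f v)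
      membership v = member-walk cycle (0F , inj₁ refl) (connected (f 0F) v)
      position : V → Fin p
      position = proj₁ ∘ membership
      ks = count (size G) position
      φ = fibres-↔ (size G) position
      adj≡ceAdj : ∀ u v → adj G u v ≡ ceAdj p ks (Inverse.to φ u) (Inverse.to φ v)
      adj≡ceAdj u v with u ≟ v
      ... | yes refl = trans (irrefl G u) (≡.sym (ceAdj-irrefl p ks (s≤s (s≤s z≤n)) (Inverse.to φ u)))
      ... | no u≢v  = trans (member-adjacency cycle (proj₂ (membership u)) (proj₂ (membership v)) u≢v)
                            (≡.sym (ceAdj≡closedAdj p ks (u≢v ∘ Injection.injective (↔⇒↣ φ))))
      position∘f : ∀ i → position (f i) ≡ i
      position∘f i with membership (f i)
      ... | j , inj₁ fi≡fj      = ≡.sym (f-injective fi≡fj)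
      ... | j , inj₂ (off , _) = ⊥-elim (off i refl)
      ks-positive : ∀ i → 1 ≤ ks i
      ks-positive i = subst (λ j → 1 ≤ ks j) (position∘f i) (≤-trans (s≤s z≤n) (rank<count _ position (f i)))

corollary1p5 : (k : ℕ) → 3 ≤ k → (G : Graph) → Connected G →
    ¬ InducedCopy 5 bull G → ¬ InducedCopy 4 claw G →
    (p : ℕ) → 7 ≤ p → HasInducedCycle G p → IndepAtLeast G 3 →
    Colorable G k
    ⊎ HasClique G (suc k)
    ⊎ Σ (Fin p → ℕ) (λ ks → (∀ i → 1 ≤ ks i) × IsoCE G p ks ×
        ((Σ (Fin p) λ i → Σ (Fin p) λ j → T (cycSucc p i j) × k < ks i + ks j)
         ⊎ ⌊ p /2⌋ * k < sumFin p ks))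
corollary1p5 k (s≤s (s≤s (s≤s z≤n))) G connected bull-free claw-free
             p (s≤s (s≤s (s≤s (s≤s (s≤s (s≤s (s≤s (z≤n {q})))))))) cycle _
  with ClawBullFree.AroundCycle.cliqueExpansion G bull-free claw-free q connected cycle
... | ks , ks-positive , iso
  with any? (λ i → any? (λ j → T? (cycSucc p i j) ×-dec (k <? ks i + ks j)))
...   | yes heavy-edge = inj₂ (inj₂ (ks , ks-positive , iso , inj₁ heavy-edge))
...   | no no-heavy-edge with ⌊ p /2⌋ * k <? sumFin p ks
...     | yes heavy = inj₂ (inj₂ (ks , ks-positive , iso , inj₂ heavy))
...     | no light  = inj₁ (IsoCE⇒Colorable G iso (colour , colour-proper))
  where
  open CliqueExpansionColouring p k ks
    (λ i j i→j → ≮⇒≥ λ k<ks → no-heavy-edge (i , j , i→j , k<ks)) (≮⇒≥ light)
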